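{- The relation $\equiv_{\mathcal T}$ on $\lambda\mu$-terms is sensible: for all unsolvable $\lambda\mu$-terms $M,N$ one has $M\equiv_{\mathcal T}N$.
   Context: Fix disjoint countably infinite sets of variables and names. $\lambda\mu$-terms: $M::=x\mid\lambda x.M\mid MM\mid\mu\alpha.{}_\beta|M|$, up to renaming of bound variables and names. Named application $(M)_\alpha N$: - $(x)_\alpha N=x$, $(\lambda x.M)_\alpha N=\lambda x.(M)_\alpha N$, $(MP)_\alpha N=((M)_\alpha N)((P)_\alpha N)$. - $(\mu\beta.{}_\gamma|M|)_\alpha N=\mu\beta.{}_\gamma|(M)_\alpha N|$ for $\gamma\ne\alpha$, and $(\mu\beta.{}_\alpha|M|)_\alpha N=\mu\beta.{}_\alpha|((M)_\alpha N)N|$. - On named terms: $({}_\gamma|M|)_\alpha N={}_\gamma|(M)_\alpha N|$ for $\gamma\ne\alpha$, and $({}_\alpha|M|)_\alpha N={}_\alpha|((M)_\alpha N)N|$. Reduction on $\lambda\mu$-terms. $\to$ is the contextual closure of - $(\lambda x.M)N\to M\{N/x\}$, - $(\mu\alpha.{}_\beta|M|)N\to\mu\alpha.({}_\beta|M|)_\alpha N$, - $\mu\gamma.{}_\alpha|\mu\beta.{}_\eta|M||\to\mu\gamma.({}_\eta|M|)\{\alpha/\beta\}$ (a $\rho$-redex; $\{\alpha/\beta\}$ renames free $\beta$ into $\alpha$). $=_{\lambda\mu\rho}$ is the equivalence generated by $\to$. Head normal forms and solvability. - Every $\lambda\mu$-term has a unique shape $\lambda\vec x_1.\mu\alpha_1.{}_{\beta_1}|\cdots\lambda\vec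 x_k.\mu\alpha_k.{}_{\beta_k}|RQ_1\cdots Q_n|\cdots|$, with $R$ a variable, a $\lambda$-redex $(\lambda y.P)D$ or a $\mu$-redex $(\mu\gamma.{}_\eta|P|)D$; the prefix is its head. - $M$ is a head normal form (hnf) iff $R$ is a variable and the head contains no $\rho$-redex. - $M$ is solvable iff $M=_{\lambda\mu\rho}H$ for some hnf $H$, and unsolvable otherwise. Resource terms and sums. - Resource terms: $t::=x\mid\lambda x.t\mid t[t_1,\dots,t_n]\mid\mu\alpha.{}_\beta|t|$, with bags finite multisets; $1$ is the empty bag and $*$ is union. - Sums are finite sets with idempotent $+$ and empty sum $0$; constructors extend multilinearly, and $0$ annihilates. - A weak composition (w.c.) of a bag $B$ is a tuple of possibly empty bags whose union is $B$. Linear substitution $t\langle B/x\rangle$: - $x\langle[v]/x\rangle=v$, and $x\langle B/x\rangle=0$ otherwise. - For $y\ne x$: $y\langle1/x\rangle=y$, and $y\langle B/x\rangle=0$ if $B\ne1$. - It commutes with $\lambda y$ and with $\mu\alpha.{}_\beta|\cdot|$. - $(t[v_1..v_n])\langle B/x\rangle=\sum_{(B_0..B_n)\text{ w.c.}}t\langle B_0/x\rangle[v_i\langle B_i/x\rangle]_i$. Linear named application $\langle t\rangle_\alpha B$: - $\langle x\rangle_\alpha 1=x$, and $\langle x\rangle_\alpha B=0$ if $B\ne1$. - It commutes with $\lambda y$ and with $\mu\gamma$. - $\langle{}_\eta|t|\rangle_\alpha B={}_\eta|\langle t\rangle_\alpha B|$ ($\eta\ne\alpha$), and $\langle{}_\alpha|t|\rangle_\alpha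 B=\sum_{(B_1,B_2)\text{ w.c.}}{}_\alpha|(\langle t\rangle_\alpha B_1)B_2|$. - $\langle t[v_1..v_n]\rangle_\alpha B=\sum_{(B_0..B_n)}(\langle t\rangle_\alpha B_0)[\langle v_i\rangle_\alpha B_i]_i$. Resource reduction. $\to_r$ is the closure under single-hole resource contexts of $(\lambda x.t)B\to t\langle B/x\rangle$, $(\mu\alpha.{}_\beta|t|)B\to\mu\alpha.\langle{}_\beta|t|\rangle_\alpha B$, and $\mu\gamma.{}_\alpha|\mu\beta.{}_\eta|t||\to\mu\gamma.({}_\eta|t|)\{\alpha/\beta\}$, extended to sums by $t+\mathcal S\to_r\mathcal T+\mathcal S$ if $t\to_r\mathcal T$ and $t\notin\mathcal S$. It is confluent and strongly normalising; $\mathrm{nf}_r(t)$ is the normal form of $t$. Taylor expansion. - $\mathcal T(x)=\{x\}$, $\mathcal T(\lambda x.M)=\lambda x.\mathcal T(M)$, $\mathcal T(\mu\alpha.{}_\beta|M|)=\mu\alpha.{}_\beta|\mathcal T(M)|$ (pointwise). - $\mathcal T(MN)=\{t[u_1..u_n]\mid t\in\mathcal T(M),n\ge0,u_i\in\mathcal T(N)\}$. - $\mathrm{NF}(\mathcal T(M))=\bigcup_{t\in\mathcal T(M)}\mathrm{nf}_r(t)$. - $M\equiv_{\mathcal T}N$ iff $\mathrm{NF}(\mathcal T(M))=\mathrm{NF}(\mathcal T(N))$. -}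

module Defs where

open import Data.Nat using (ℕ; zero; suc; _≡ᵇ_; _<ᵇ_; pred)
open import Data.Bool using (Bool; true; false; if_then_else_)
open import Data.List using (List; []; _∷_; _++_; map; concatMap)
open import Data.List.Relation.Unary.All using (All)
open import Data.List.Relation.Unary.Any using (Any)
open import Data.Product using (Σ; ∃; ∃-syntax; _×_; _,_; proj₁; proj₂)
open import Relation.Nullary using (¬_)
open import Relation.Binary.Construct.Closure.ReflexiveTransitive using (Star)
open import Relation.Binary.Construct.Closure.Equivalence using (EqClosure)

-- Conventions: locally nameless-free de Bruijn representation, with two
-- independent index sorts: variables and names.  Terms are thereby
-- identified up to renaming of bound variables and names.
--   var x      : variable with de Bruijn index x
--   lam M      : λ binding variable 0 of M
--   mu β M     : μα.[β]M  where α is name 0 of the scope of M, and β is a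
--                name index in that scope (so β = 0 means β = α).

data Term : Set where
  var : ℕ → Term
  lam : Term → Term
  app : Term → Term → Term
  mu  : ℕ → Term → Term

lift : (ℕ → ℕ) → ℕ → ℕ
lift f zero    = zero
lift f (suc i) = suc (f i)

vren : (ℕ → ℕ) → Term → Term
vren f (var x)   = var (f x)
vren f (lam M)   = lam (vren (lift f) M)
vren f (app M N) = app (vren f M) (vren f N)
vren f (mu β M)  = mu β (vren f M)

nren : (ℕ → ℕ) → Term → Term
nren f (var x)   = var x
nren f (lam M)   = lam (nren f M)
nren f (app M N) = app (nren f M) (nren f N)
nren f (mu β M)  = mu (lift f β) (nren (lift f) M)

exts : (ℕ → Term) → ℕ → Term
exts σ zero    = var zero
exts σ (suc i) = vren suc (σ i)

vsub : (ℕ → Term) → Term → Term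
vsub σ (var x)   = σ x
vsub σ (lam M)   = lam (vsub (exts σ) M)
vsub σ (app M N) = app (vsub σ M) (vsub σ N)
vsub σ (mu β M)  = mu β (vsub (λ i → nren suc (σ i)) M)

single : Term → ℕ → Term
single N zero    = N
single N (suc i) = var i

rho : ℕ → ℕ → ℕ
rho α zero    = α
rho α (suc i) = i

-- named application (M)_α N ;  nappMu α β M N = μ_.(₍β₎|M|)_α N where
-- α, β, M and N all live in the scope of the μ-body
mutual
  napp : ℕ → Term → Term → Term
  napp α (var x)   N = var x
  napp α (lam M)   N = lam (napp α M (vren suc N))
  napp α (app M P) N = app (napp α M N) (napp α P N)
  napp α (mu β M)  N = nappMu (suc α) β M (nren suc N)

  nappMu : ℕ → ℕ → Term → Term → Term
  nappMu α β M N =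
    if β ≡ᵇ α then mu β (app (napp α M N) N) else mu β (napp α M N)

data _⟶_ : Term → Term → Set where
  βred  : ∀ {M N} → app (lam M) N ⟶ vsub (single N) M
  μred  : ∀ {β M N} → app (mu β M) N ⟶ nappMu zero β M (nren suc N)
  ρred  : ∀ {α η M} → mu α (mu η M) ⟶ mu (rho α η) (nren (rho α) M)
  ξlam  : ∀ {M M'} → M ⟶ M' → lam M ⟶ lam M'
  ξappL : ∀ {M M' N} → M ⟶ M' → app M N ⟶ app M' N
  ξappR : ∀ {M N N'} → N ⟶ N' → app M N ⟶ app M N'
  ξmu   : ∀ {β M M'} → M ⟶ M' → mu β M ⟶ mu β M'

_=λμρ_ : Term → Term → Set
_=λμρ_ = EqClosure _⟶_

data IsVarApp : Term → Set where
  ivar : ∀ {x} → IsVarApp (var x)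
  iapp : ∀ {M N} → IsVarApp M → IsVarApp (app M N)

data IsMu : Term → Set where
  isMu : ∀ {β M} → IsMu (mu β M)

-- HNF: head λx⃗₁.μα₁.[β₁]|⋯ R Q₁⋯Qₙ|, R a variable, no ρ-redex in the head
-- (a ρ-redex in the head is exactly a μ directly under a head μ)
data HNF : Term → Set where
  hlam : ∀ {M} → HNF M → HNF (lam M)
  hmu  : ∀ {β M} → ¬ IsMu M → HNF M → HNF (mu β M)
  hvar : ∀ {M} → IsVarApp M → HNF M

Solvable : Term → Set
Solvable M = ∃[ H ] (HNF H × M =λμρ H)

Unsolvable : Term → Set
Unsolvable M = ¬ Solvable M

-- Resource terms (same de Bruijn conventions); bags are lists, considered
-- up to permutation via the equivalence _~_ below.  Sums are lists,
-- considered as finite sets (only membership matters).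

data RTerm : Set where
  rvar : ℕ → RTerm
  rlam : RTerm → RTerm
  rapp : RTerm → List RTerm → RTerm
  rmu  : ℕ → RTerm → RTerm

Bag : Set
Bag = List RTerm

Sum : Set
Sum = List RTerm

mutual
  data _~_ : RTerm → RTerm → Set where
    ~var : ∀ {x} → rvar x ~ rvar x
    ~lam : ∀ {t t'} → t ~ t' → rlam t ~ rlam t'
    ~mu  : ∀ {β t t'} → t ~ t' → rmu β t ~ rmu β t'
    ~app : ∀ {t t' B B'} → t ~ t' → B ~B B' → rapp t B ~ rapp t' B'

  data _~B_ : Bag → Bag → Set where
    ~[]    : [] ~B []
    ~∷     : ∀ {t t' B B'} → t ~ t' → B ~B B' → (t ∷ B) ~B (t' ∷ B')
    ~swap  : ∀ {t u B} → (t ∷ u ∷ B) ~B (u ∷ t ∷ B)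
    ~trans : ∀ {B₁ B₂ B₃} → B₁ ~B B₂ → B₂ ~B B₃ → B₁ ~B B₃

mutual
  rvren : (ℕ → ℕ) → RTerm → RTerm
  rvren f (rvar x)   = rvar (f x)
  rvren f (rlam t)   = rlam (rvren (lift f) t)
  rvren f (rapp t B) = rapp (rvren f t) (rvrenB f B)
  rvren f (rmu β t)  = rmu β (rvren f t)

  rvrenB : (ℕ → ℕ) → Bag → Bag
  rvrenB f []      = []
  rvrenB f (t ∷ B) = rvren f t ∷ rvrenB f B

mutual
  rnren : (ℕ → ℕ) → RTerm → RTerm
  rnren f (rvar x)   = rvar x
  rnren f (rlam t)   = rlam (rnren f t)
  rnren f (rapp t B) = rapp (rnren f t) (rnrenB f B)
  rnren f (rmu β t)  = rmu (lift f β) (rnren (lift f) t)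

  rnrenB : (ℕ → ℕ) → Bag → Bag
  rnrenB f []      = []
  rnrenB f (t ∷ B) = rnren f t ∷ rnrenB f B

-- all weak compositions (B₁ , B₂) of a bag B (possibly with repetitions)
splits : {A : Set} → List A → List (List A × List A)
splits []      = ([] , []) ∷ []
splits (a ∷ as) =
  concatMap (λ p → (a ∷ proj₁ p , proj₂ p) ∷ (proj₁ p , a ∷ proj₂ p) ∷ [])
            (splits as)

-- linear substitution t⟨B/x⟩ where x is the binder being removed at depth x
-- (variables above x are lowered by one)
lsubVar : ℕ → Bag → ℕ → Sum
lsubVar x []          y =
  if y ≡ᵇ x then [] else (rvar (if y <ᵇ x then y else pred y) ∷ [])
lsubVar x (v ∷ [])    y = if y ≡ᵇ x then v ∷ [] else []
lsubVar x (_ ∷ _ ∷ _) y = []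

mutual
  lsub : ℕ → Bag → RTerm → Sum
  lsub x B (rvar y)    = lsubVar x B y
  lsub x B (rlam t)    = map rlam (lsub (suc x) (rvrenB suc B) t)
  lsub x B (rmu β t)   = map (rmu β) (lsub x (rnrenB suc B) t)
  lsub x B (rapp t vs) =
    concatMap (λ p → concatMap (λ t' → map (rapp t') (lsubB x (proj₂ p) vs))
                               (lsub x (proj₁ p) t))
              (splits B)

  -- sum over w.c. (B₁..Bₙ) of B of [v₁⟨B₁/x⟩ … vₙ⟨Bₙ/x⟩]
  lsubB : ℕ → Bag → List RTerm → List Bag
  lsubB x []      []       = [] ∷ []
  lsubB x (_ ∷ _) []       = []
  lsubB x B       (v ∷ vs) =
    concatMap (λ p → concatMap (λ u → map (u ∷_) (lsubB x (proj₂ p) vs))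
                               (lsub x (proj₁ p) v))
              (splits B)

-- linear named application ⟨t⟩_α B ;  lnappMu α β B t = μ_.⟨₍β₎|t|⟩_α B
-- with α, β, B, t in the scope of the μ-body
mutual
  lnapp : ℕ → Bag → RTerm → Sum
  lnapp α []      (rvar x) = rvar x ∷ []
  lnapp α (_ ∷ _) (rvar x) = []
  lnapp α B (rlam t)       = map rlam (lnapp α (rvrenB suc B) t)
  lnapp α B (rmu β t)      = lnappMu (suc α) β (rnrenB suc B) t
  lnapp α B (rapp t vs)    =
    concatMap (λ p → concatMap (λ t' → map (rapp t') (lnappB α (proj₂ p) vs))
                               (lnapp α (proj₁ p) t))
              (splits B)

  lnappB : ℕ → Bag → List RTerm → List Bag
  lnappB α []      []       = [] ∷ []
  lnappB α (_ ∷ _) []       = []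
  lnappB α B       (v ∷ vs) =
    concatMap (λ p → concatMap (λ u → map (u ∷_) (lnappB α (proj₂ p) vs))
                               (lnapp α (proj₁ p) v))
              (splits B)

  lnappMu : ℕ → ℕ → Bag → RTerm → Sum
  lnappMu α β B t =
    if β ≡ᵇ α
    then concatMap (λ p → map (λ t' → rmu β (rapp t' (proj₂ p)))
                              (lnapp α (proj₁ p) t))
                   (splits B)
    else map (rmu β) (lnapp α B t)

data _⟶r_ : RTerm → Sum → Set where
  rβ     : ∀ {t B} → rapp (rlam t) B ⟶r lsub zero B t
  rμ     : ∀ {β t B} → rapp (rmu β t) B ⟶r lnappMu zero β (rnrenB suc B) t
  rρ     : ∀ {α η t} →
           rmu α (rmu η t) ⟶r (rmu (rho α η) (rnren (rho α) t) ∷ [])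
  rξlam  : ∀ {t S} → t ⟶r S → rlam t ⟶r map rlam S
  rξmu   : ∀ {β t S} → t ⟶r S → rmu β t ⟶r map (rmu β) S
  rξappL : ∀ {t S B} → t ⟶r S → rapp t B ⟶r map (λ s → rapp s B) S
  rξappB : ∀ {u t S B₁ B₂} → t ⟶r S →
           rapp u (B₁ ++ t ∷ B₂) ⟶r map (λ s → rapp u (B₁ ++ s ∷ B₂)) S

data _⟹_ : Sum → Sum → Set where
  step : ∀ {S₁ t T S₂} → t ⟶r T → (S₁ ++ t ∷ S₂) ⟹ (S₁ ++ T ++ S₂)

RNormal : RTerm → Set
RNormal t = ∀ {S} → ¬ (t ⟶r S)

-- u ∈ nf_r(t)  (up to multiset equality of bags)
_∈nf_ : RTerm → RTerm → Set
u ∈nf t = ∃[ S ] (Star _⟹_ (t ∷ []) S × All RNormal S × Any (λ s → s ~ u) S)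

data _∈T_ : RTerm → Term → Set where
  Tvar : ∀ {x} → rvar x ∈T var x
  Tlam : ∀ {t M} → t ∈T M → rlam t ∈T lam M
  Tmu  : ∀ {β t M} → t ∈T M → rmu β t ∈T mu β M
  Tapp : ∀ {t B M N} → t ∈T M → All (λ u → u ∈T N) B → rapp t B ∈T app M N

_∈NF_ : RTerm → Term → Set
u ∈NF M = ∃[ t ] (t ∈T M × u ∈nf t)

_≡T_ : Term → Term → Set
M ≡T N = ∀ u → (u ∈NF M → u ∈NF N) × (u ∈NF N → u ∈NF M)

-- Every element of NF(𝒯(M)) witnesses that M is solvable, so unsolvable
-- terms all have the empty normal Taylor expansion.
--
-- The witness comes from an invariant saying that t approximates a reduct
-- of M, reducts being chosen independently at every node of t.  It holds
-- for t ∈ 𝒯(M), and resource reduction preserves it because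
-- λμρ-reduction is stable under substitution and under named application
-- (the latter needs the commutation of named applications and, for the
-- ρ-rule, their merging under a renaming of names).  A normal resource term
-- has no β-, μ- or ρ-redex at its head, so the reduct it approximates is a
-- head normal form.

module Submission where

open import Data.Bool using (true; false; T; if_then_else_)
open import Data.Empty using (⊥-elim)
open import Data.List using (List; []; _∷_; map; concatMap)
open import Data.List.Relation.Unary.All as All using (All; []; _∷_)
open import Data.List.Relation.Unary.All.Properties using (map⁺; concat⁺; ++⁺; ++⁻)
open import Data.List.Relation.Unary.Any using (Any; here; there)
open import Data.Nat using (ℕ; zero; suc; _≡ᵇ_; _<ᵇ_; pred; _≟_)
open import Data.Nat.Properties using (suc-injective; 0≢1+n; ≡ᵇ⇒≡; ≡⇒≡ᵇ)
open import Data.Product using (∃-syntax; _×_; _,_; proj₁; proj₂)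
open import Data.Sum using (_⊎_; inj₁; inj₂)
open import Data.Unit using (⊤; tt)
open import Function using (_∘_)
open import Relation.Nullary using (¬_; yes; no)
open import Relation.Binary.PropositionalEquality
open import Relation.Binary.Construct.Closure.ReflexiveTransitive as Star using (Star; ε; _◅_; _◅◅_)
open import Relation.Binary.Construct.Closure.Symmetric using (fwd)

open import Defs

open ≡-Reasoning

-- Renaming and substitution

lift-cong : ∀ {f g} → (∀ i → f i ≡ g i) → ∀ i → lift f i ≡ lift g i
lift-cong e zero    = refl
lift-cong e (suc i) = cong suc (e i)

lift-∘ : ∀ f g i → lift f (lift g i) ≡ lift (λ j → f (g j)) i
lift-∘ f g zero    = refl
lift-∘ f g (suc i) = refl

lift-id : ∀ {f} → (∀ i → f i ≡ i) → ∀ i → lift f i ≡ i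
lift-id e zero    = refl
lift-id e (suc i) = cong suc (e i)

vren-cong : ∀ {f g} → (∀ i → f i ≡ g i) → ∀ M → vren f M ≡ vren g M
vren-cong e (var x)   = cong var (e x)
vren-cong e (lam M)   = cong lam (vren-cong (lift-cong e) M)
vren-cong e (app M N) = cong₂ app (vren-cong e M) (vren-cong e N)
vren-cong e (mu β M)  = cong (mu β) (vren-cong e M)

nren-cong : ∀ {f g} → (∀ i → f i ≡ g i) → ∀ M → nren f M ≡ nren g M
nren-cong e (var x)   = refl
nren-cong e (lam M)   = cong lam (nren-cong e M)
nren-cong e (app M N) = cong₂ app (nren-cong e M) (nren-cong e N)
nren-cong e (mu β M)  = cong₂ mu (lift-cong e β) (nren-cong (lift-cong e) M)

vren-∘ : ∀ f g M → vren f (vren g M) ≡ vren (λ i → f (g i)) M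
vren-∘ f g (var x)   = refl
vren-∘ f g (lam M)   = cong lam (trans (vren-∘ (lift f) (lift g) M) (vren-cong (lift-∘ f g) M))
vren-∘ f g (app M N) = cong₂ app (vren-∘ f g M) (vren-∘ f g N)
vren-∘ f g (mu β M)  = cong (mu β) (vren-∘ f g M)

nren-∘ : ∀ f g M → nren f (nren g M) ≡ nren (λ i → f (g i)) M
nren-∘ f g (var x)   = refl
nren-∘ f g (lam M)   = cong lam (nren-∘ f g M)
nren-∘ f g (app M N) = cong₂ app (nren-∘ f g M) (nren-∘ f g N)
nren-∘ f g (mu β M)  =
  cong₂ mu (lift-∘ f g β) (trans (nren-∘ (lift f) (lift g) M) (nren-cong (lift-∘ f g) M))

nren-id : ∀ {f} → (∀ i → f i ≡ i) → ∀ M → nren f M ≡ M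
nren-id e (var x)   = refl
nren-id e (lam M)   = cong lam (nren-id e M)
nren-id e (app M N) = cong₂ app (nren-id e M) (nren-id e N)
nren-id e (mu β M)  = cong₂ mu (lift-id e β) (nren-id (lift-id e) M)

vren-suc-comm : ∀ f M → vren (lift f) (vren suc M) ≡ vren suc (vren f M)
vren-suc-comm f M = trans (vren-∘ (lift f) suc M) (sym (vren-∘ suc f M))

nren-suc-comm : ∀ f M → nren (lift f) (nren suc M) ≡ nren suc (nren f M)
nren-suc-comm f M = trans (nren-∘ (lift f) suc M) (sym (nren-∘ suc f M))

nren-rho-suc : ∀ a M → nren (rho a) (nren suc M) ≡ M
nren-rho-suc a M = trans (nren-∘ (rho a) suc M) (nren-id (λ _ → refl) M)

vren-nren-comm : ∀ f g M → vren f (nren g M) ≡ nren g (vren f M)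
vren-nren-comm f g (var x)   = refl
vren-nren-comm f g (lam M)   = cong lam (vren-nren-comm (lift f) g M)
vren-nren-comm f g (app M N) = cong₂ app (vren-nren-comm f g M) (vren-nren-comm f g N)
vren-nren-comm f g (mu β M)  = cong (mu _) (vren-nren-comm f (lift g) M)

vsub-cong : ∀ {σ τ} → (∀ i → σ i ≡ τ i) → ∀ M → vsub σ M ≡ vsub τ M
vsub-cong e (var x)   = e x
vsub-cong e (lam M)   = cong lam (vsub-cong (λ { zero → refl ; (suc i) → cong (vren suc) (e i) }) M)
vsub-cong e (app M N) = cong₂ app (vsub-cong e M) (vsub-cong e N)
vsub-cong e (mu β M)  = cong (mu β) (vsub-cong (λ i → cong (nren suc) (e i)) M)

vsub-id : ∀ {σ} → (∀ i → σ i ≡ var i) → ∀ M → vsub σ M ≡ M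
vsub-id e (var x)   = e x
vsub-id e (lam M)   = cong lam (vsub-id (λ { zero → refl ; (suc i) → cong (vren suc) (e i) }) M)
vsub-id e (app M N) = cong₂ app (vsub-id e M) (vsub-id e N)
vsub-id e (mu β M)  = cong (mu β) (vsub-id (λ i → cong (nren suc) (e i)) M)

vsub-vren : ∀ σ f M → vsub σ (vren f M) ≡ vsub (λ i → σ (f i)) M
vsub-vren σ f (var x)   = refl
vsub-vren σ f (lam M)   =
  cong lam (trans (vsub-vren (exts σ) (lift f) M) (vsub-cong (λ { zero → refl ; (suc i) → refl }) M))
vsub-vren σ f (app M N) = cong₂ app (vsub-vren σ f M) (vsub-vren σ f N)
vsub-vren σ f (mu β M)  = cong (mu β) (vsub-vren _ f M)

vren-vsub : ∀ f σ M → vren f (vsub σ M) ≡ vsub (λ i → vren f (σ i)) M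
vren-vsub f σ (var x)   = refl
vren-vsub f σ (lam M)   = cong lam (trans (vren-vsub (lift f) (exts σ) M) (vsub-cong exts-comm M))
  where
  exts-comm : ∀ i → vren (lift f) (exts σ i) ≡ exts (λ j → vren f (σ j)) i
  exts-comm zero    = refl
  exts-comm (suc i) = vren-suc-comm f (σ i)
vren-vsub f σ (app M N) = cong₂ app (vren-vsub f σ M) (vren-vsub f σ N)
vren-vsub f σ (mu β M)  =
  cong (mu β) (trans (vren-vsub f _ M) (vsub-cong (λ i → vren-nren-comm f suc (σ i)) M))

nren-vsub : ∀ g σ M → nren g (vsub σ M) ≡ vsub (λ i → nren g (σ i)) (nren g M)
nren-vsub g σ (var x)   = refl
nren-vsub g σ (lam M)   = cong lam (trans (nren-vsub g (exts σ) M)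
  (vsub-cong (λ { zero → refl ; (suc i) → sym (vren-nren-comm suc g (σ i)) }) (nren g M)))
nren-vsub g σ (app M N) = cong₂ app (nren-vsub g σ M) (nren-vsub g σ N)
nren-vsub g σ (mu β M)  = cong (mu _) (trans (nren-vsub (lift g) _ M)
  (vsub-cong (λ i → nren-suc-comm g (σ i)) (nren (lift g) M)))

vsub-vsub : ∀ τ σ M → vsub τ (vsub σ M) ≡ vsub (λ i → vsub τ (σ i)) M
vsub-vsub τ σ (var x)   = refl
vsub-vsub τ σ (lam M)   = cong lam (trans (vsub-vsub (exts τ) (exts σ) M) (vsub-cong exts-comm M))
  where
  exts-comm : ∀ i → vsub (exts τ) (exts σ i) ≡ exts (λ j → vsub τ (σ j)) i
  exts-comm zero    = refl
  exts-comm (suc i) = trans (vsub-vren (exts τ) suc (σ i)) (sym (vren-vsub suc τ (σ i)))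
vsub-vsub τ σ (app M N) = cong₂ app (vsub-vsub τ σ M) (vsub-vsub τ σ N)
vsub-vsub τ σ (mu β M)  =
  cong (mu β) (trans (vsub-vsub _ _ M) (vsub-cong (λ i → sym (nren-vsub suc τ (σ i))) M))

-- Named application

nappMu-≡ : ∀ {a β} M N → β ≡ a → nappMu a β M N ≡ mu β (app (napp a M N) N)
nappMu-≡ {a} {β} M N β≡a with β ≡ᵇ a in eq
... | true  = refl
... | false = ⊥-elim (subst T eq (≡⇒≡ᵇ β a β≡a))

nappMu-≢ : ∀ {a β} M N → β ≢ a → nappMu a β M N ≡ mu β (napp a M N)
nappMu-≢ {a} {β} M N β≢a with β ≡ᵇ a in eq
... | true  = ⊥-elim (β≢a (≡ᵇ⇒≡ β a (subst T (sym eq) tt)))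
... | false = refl

InjectiveAt : (ℕ → ℕ) → ℕ → Set
InjectiveAt f a = ∀ b → f b ≡ f a → b ≡ a

lift-injectiveAt : ∀ {f a} → InjectiveAt f a → InjectiveAt (lift f) (suc a)
lift-injectiveAt inj zero    ()
lift-injectiveAt inj (suc b) q = cong suc (inj b (suc-injective q))

lift-injectiveAt-zero : ∀ f → InjectiveAt (lift f) zero
lift-injectiveAt-zero f zero    q = refl
lift-injectiveAt-zero f (suc b) ()

suc-injectiveAt : ∀ a → InjectiveAt suc a
suc-injectiveAt a b = suc-injective

vren-napp : ∀ f α M N → vren f (napp α M N) ≡ napp α (vren f M) (vren f N)
vren-nappMu : ∀ f a β M N → vren f (nappMu a β M N) ≡ nappMu a β (vren f M) (vren f N)
vren-napp f α (var x)   N = refl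
vren-napp f α (lam M)   N = cong lam (trans (vren-napp (lift f) α M (vren suc N))
  (cong (napp α (vren (lift f) M)) (vren-suc-comm f N)))
vren-napp f α (app M P) N = cong₂ app (vren-napp f α M N) (vren-napp f α P N)
vren-napp f α (mu β M)  N = trans (vren-nappMu f (suc α) β M (nren suc N))
  (cong (nappMu (suc α) β (vren f M)) (vren-nren-comm f suc N))
vren-nappMu f a β M N with β ≟ a
... | yes p = begin
  vren f (nappMu a β M N)
    ≡⟨ cong (vren f) (nappMu-≡ M N p) ⟩
  mu β (app (vren f (napp a M N)) (vren f N))
    ≡⟨ cong (λ X → mu β (app X (vren f N))) (vren-napp f a M N) ⟩
  mu β (app (napp a (vren f M) (vren f N)) (vren f N))
    ≡⟨ nappMu-≡ (vren f M) (vren f N) p ⟨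
  nappMu a β (vren f M) (vren f N) ∎
... | no p = begin
  vren f (nappMu a β M N)                       ≡⟨ cong (vren f) (nappMu-≢ M N p) ⟩
  mu β (vren f (napp a M N))                    ≡⟨ cong (mu β) (vren-napp f a M N) ⟩
  mu β (napp a (vren f M) (vren f N))           ≡⟨ nappMu-≢ (vren f M) (vren f N) p ⟨
  nappMu a β (vren f M) (vren f N)              ∎

nren-napp : ∀ f α → InjectiveAt f α → ∀ M N →
  nren f (napp α M N) ≡ napp (f α) (nren f M) (nren f N)
nren-nappMu : ∀ f a → InjectiveAt (lift f) a → ∀ β M N →
  nren f (nappMu a β M N) ≡ nappMu (lift f a) (lift f β) (nren (lift f) M) (nren (lift f) N)
nren-napp f α inj (var x)   N = refl
nren-napp f α inj (lam M)   N = cong lam (trans (nren-napp f α inj M (vren suc N))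
  (cong (napp _ (nren f M)) (sym (vren-nren-comm suc f N))))
nren-napp f α inj (app M P) N = cong₂ app (nren-napp f α inj M N) (nren-napp f α inj P N)
nren-napp f α inj (mu β M)  N = trans (nren-nappMu f (suc α) (lift-injectiveAt inj) β M (nren suc N))
  (cong (nappMu (suc (f α)) (lift f β) (nren (lift f) M)) (nren-suc-comm f N))
nren-nappMu f a inj β M N with β ≟ a
... | yes p = begin
  nren f (nappMu a β M N)
    ≡⟨ cong (nren f) (nappMu-≡ M N p) ⟩
  mu (lift f β) (app (nren (lift f) (napp a M N)) N')
    ≡⟨ cong (λ X → mu (lift f β) (app X N')) (nren-napp (lift f) a inj M N) ⟩
  mu (lift f β) (app (napp (lift f a) M' N') N')
    ≡⟨ nappMu-≡ M' N' (cong (lift f) p) ⟨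
  nappMu (lift f a) (lift f β) M' N' ∎
  where M' = nren (lift f) M; N' = nren (lift f) N
... | no p = begin
  nren f (nappMu a β M N)
    ≡⟨ cong (nren f) (nappMu-≢ M N p) ⟩
  mu (lift f β) (nren (lift f) (napp a M N))
    ≡⟨ cong (mu (lift f β)) (nren-napp (lift f) a inj M N) ⟩
  mu (lift f β) (napp (lift f a) M' N')
    ≡⟨ nappMu-≢ M' N' (λ q → p (inj β q)) ⟨
  nappMu (lift f a) (lift f β) M' N' ∎
  where M' = nren (lift f) M; N' = nren (lift f) N

Fresh : ℕ → Term → Set
Fresh a (var x)   = ⊤
Fresh a (lam M)   = Fresh a M
Fresh a (app M N) = Fresh a M × Fresh a N
Fresh a (mu β M)  = β ≢ suc a × Fresh (suc a) M

Fresh-nren-outside : ∀ {f a} → (∀ i → f i ≢ a) → ∀ M → Fresh a (nren f M)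
Fresh-nren-outside h (var x)   = tt
Fresh-nren-outside h (lam M)   = Fresh-nren-outside h M
Fresh-nren-outside h (app M N) = Fresh-nren-outside h M , Fresh-nren-outside h N
Fresh-nren-outside {f} {a} h (mu β M) = h′ β , Fresh-nren-outside h′ M
  where
  h′ : ∀ i → lift f i ≢ suc a
  h′ zero    ()
  h′ (suc i) q = h i (suc-injective q)

Fresh-nren : ∀ {f a b} → (∀ i → f i ≡ b → i ≡ a) → ∀ M → Fresh a M → Fresh b (nren f M)
Fresh-nren h (var x)   _         = tt
Fresh-nren h (lam M)   fr        = Fresh-nren h M fr
Fresh-nren h (app M N) (fM , fN) = Fresh-nren h M fM , Fresh-nren h N fN
Fresh-nren {f} {a} {b} h (mu β M) (β≢ , fr) = (λ q → β≢ (h′ β q)) , Fresh-nren h′ M fr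
  where
  h′ : ∀ i → lift f i ≡ suc b → i ≡ suc a
  h′ zero    ()
  h′ (suc i) q = cong suc (h i (suc-injective q))

Fresh-zero-nren-suc : ∀ M → Fresh zero (nren suc M)
Fresh-zero-nren-suc = Fresh-nren-outside (λ i ())

Fresh-suc-nren-suc : ∀ {a} M → Fresh a M → Fresh (suc a) (nren suc M)
Fresh-suc-nren-suc = Fresh-nren (λ i → suc-injective)

Fresh-vren : ∀ f a M → Fresh a M → Fresh a (vren f M)
Fresh-vren f a (var x)   _         = tt
Fresh-vren f a (lam M)   fr        = Fresh-vren (lift f) a M fr
Fresh-vren f a (app M N) (fM , fN) = Fresh-vren f a M fM , Fresh-vren f a N fN
Fresh-vren f a (mu β M)  (β≢ , fr) = β≢ , Fresh-vren f (suc a) M fr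

napp-fresh : ∀ a M N → Fresh a M → napp a M N ≡ M
napp-fresh a (var x)   N _         = refl
napp-fresh a (lam M)   N fr        = cong lam (napp-fresh a M (vren suc N) fr)
napp-fresh a (app M P) N (fM , fP) = cong₂ app (napp-fresh a M N fM) (napp-fresh a P N fP)
napp-fresh a (mu β M)  N (β≢ , fr) =
  trans (nappMu-≢ M (nren suc N) β≢) (cong (mu β) (napp-fresh (suc a) M (nren suc N) fr))

-- Freshness is needed because napp α leaves a variable alone but would act
-- on the term substituted for it.
vsub-napp : ∀ σ α → (∀ i → Fresh α (σ i)) → ∀ M N →
  vsub σ (napp α M N) ≡ napp α (vsub σ M) (vsub σ N)
vsub-nappMu : ∀ σ a → (∀ i → Fresh a (nren suc (σ i))) → ∀ β M N → let σ′ = λ i → nren suc (σ i) in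
  vsub σ (nappMu a β M N) ≡ nappMu a β (vsub σ′ M) (vsub σ′ N)
vsub-napp σ α h (var x)   N = sym (napp-fresh α (σ x) (vsub σ N) (h x))
vsub-napp σ α h (lam M)   N = cong lam (trans (vsub-napp (exts σ) α h′ M (vren suc N))
  (cong (napp α (vsub (exts σ) M)) (trans (vsub-vren (exts σ) suc N) (sym (vren-vsub suc σ N)))))
  where
  h′ : ∀ i → Fresh α (exts σ i)
  h′ zero    = tt
  h′ (suc i) = Fresh-vren suc α (σ i) (h i)
vsub-napp σ α h (app M P) N = cong₂ app (vsub-napp σ α h M N) (vsub-napp σ α h P N)
vsub-napp σ α h (mu β M)  N =
  trans (vsub-nappMu σ (suc α) (λ i → Fresh-suc-nren-suc (σ i) (h i)) β M (nren suc N))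
        (cong (nappMu (suc α) β (vsub (λ i → nren suc (σ i)) M)) (sym (nren-vsub suc σ N)))
vsub-nappMu σ a h β M N with β ≟ a
... | yes p = begin
  vsub σ (nappMu a β M N)
    ≡⟨ cong (vsub σ) (nappMu-≡ M N p) ⟩
  mu β (app (vsub σ′ (napp a M N)) (vsub σ′ N))
    ≡⟨ cong (λ X → mu β (app X (vsub σ′ N))) (vsub-napp σ′ a h M N) ⟩
  mu β (app (napp a (vsub σ′ M) (vsub σ′ N)) (vsub σ′ N))
    ≡⟨ nappMu-≡ (vsub σ′ M) (vsub σ′ N) p ⟨
  nappMu a β (vsub σ′ M) (vsub σ′ N) ∎
  where σ′ = λ i → nren suc (σ i)
... | no p = begin
  vsub σ (nappMu a β M N)                         ≡⟨ cong (vsub σ) (nappMu-≢ M N p) ⟩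
  mu β (vsub σ′ (napp a M N))                     ≡⟨ cong (mu β) (vsub-napp σ′ a h M N) ⟩
  mu β (napp a (vsub σ′ M) (vsub σ′ N))           ≡⟨ nappMu-≢ (vsub σ′ M) (vsub σ′ N) p ⟨
  nappMu a β (vsub σ′ M) (vsub σ′ N)              ∎
  where σ′ = λ i → nren suc (σ i)

-- N′ is the argument as seen before the substitution, e.g. vren suc N when
-- σ instantiates the outermost variable.
napp-vsub : ∀ α σ P N N′ → vsub (λ i → napp α (σ i) N) N′ ≡ N →
  napp α (vsub σ P) N ≡ vsub (λ i → napp α (σ i) N) (napp α P N′)
napp-vsub α σ (var x)   N N′ e = refl
napp-vsub α σ (lam P)   N N′ e =
  cong lam (trans (napp-vsub α (exts σ) P (vren suc N) (vren suc N′) e′)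
                  (vsub-cong exts-comm (napp α P (vren suc N′))))
  where
  τ = λ i → napp α (σ i) N
  exts-comm : ∀ i → napp α (exts σ i) (vren suc N) ≡ exts τ i
  exts-comm zero    = refl
  exts-comm (suc i) = sym (vren-napp suc α (σ i) N)
  e′ : vsub (λ i → napp α (exts σ i) (vren suc N)) (vren suc N′) ≡ vren suc N
  e′ = begin
    vsub (λ i → napp α (exts σ i) (vren suc N)) (vren suc N′)
      ≡⟨ vsub-vren _ suc N′ ⟩
    vsub (λ i → napp α (vren suc (σ i)) (vren suc N)) N′
      ≡⟨ vsub-cong (λ i → sym (vren-napp suc α (σ i) N)) N′ ⟩
    vsub (λ i → vren suc (τ i)) N′
      ≡⟨ vren-vsub suc τ N′ ⟨
    vren suc (vsub τ N′)
      ≡⟨ cong (vren suc) e ⟩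
    vren suc N ∎
napp-vsub α σ (app P Q) N N′ e = cong₂ app (napp-vsub α σ P N N′ e) (napp-vsub α σ Q N N′ e)
napp-vsub α σ (mu β P)  N N′ e = proof
  where
  τ  = λ i → napp α (σ i) N
  σ₁ = λ i → nren suc (σ i)
  τ₁ = λ i → nren suc (τ i)
  N₁  = nren suc N
  N₁′ = nren suc N′
  τ₁-napp : ∀ i → napp (suc α) (σ₁ i) N₁ ≡ τ₁ i
  τ₁-napp i = sym (nren-napp suc α (suc-injectiveAt α) (σ i) N)
  e₁ : vsub τ₁ N₁′ ≡ N₁
  e₁ = trans (sym (nren-vsub suc τ N′)) (cong (nren suc) e)
  ih : napp (suc α) (vsub σ₁ P) N₁ ≡ vsub τ₁ (napp (suc α) P N₁′)
  ih = trans (napp-vsub (suc α) σ₁ P N₁ N₁′ (trans (vsub-cong τ₁-napp N₁′) e₁))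
             (vsub-cong τ₁-napp (napp (suc α) P N₁′))
  proof : nappMu (suc α) β (vsub σ₁ P) N₁ ≡ vsub τ (nappMu (suc α) β P N₁′)
  proof with β ≟ suc α
  ... | yes p = begin
    nappMu (suc α) β (vsub σ₁ P) N₁              ≡⟨ nappMu-≡ (vsub σ₁ P) N₁ p ⟩
    mu β (app (napp (suc α) (vsub σ₁ P) N₁) N₁)  ≡⟨ cong₂ (λ X Y → mu β (app X Y)) ih (sym e₁) ⟩
    vsub τ (mu β (app (napp (suc α) P N₁′) N₁′)) ≡⟨ cong (vsub τ) (nappMu-≡ P N₁′ p) ⟨
    vsub τ (nappMu (suc α) β P N₁′)              ∎
  ... | no p = begin
    nappMu (suc α) β (vsub σ₁ P) N₁              ≡⟨ nappMu-≢ (vsub σ₁ P) N₁ p ⟩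
    mu β (napp (suc α) (vsub σ₁ P) N₁)           ≡⟨ cong (mu β) ih ⟩
    vsub τ (mu β (napp (suc α) P N₁′))           ≡⟨ cong (vsub τ) (nappMu-≢ P N₁′ p) ⟨
    vsub τ (nappMu (suc α) β P N₁′)              ∎

napp-napp : ∀ a b → a ≢ b → ∀ Q R N → Fresh b N →
  napp a (napp b Q R) N ≡ napp b (napp a Q N) (napp a R N)
napp-napp a b a≢b (var x)   R N fr = refl
napp-napp a b a≢b (lam Q)   R N fr =
  cong lam (trans (napp-napp a b a≢b Q (vren suc R) (vren suc N) (Fresh-vren suc b N fr))
                  (cong (napp b (napp a Q (vren suc N))) (sym (vren-napp suc a R N))))
napp-napp a b a≢b (app Q P) R N fr = cong₂ app (napp-napp a b a≢b Q R N fr) (napp-napp a b a≢b P R N fr)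
napp-napp a b a≢b (mu γ M)  R N fr = proof
  where
  R₁  = nren suc R
  N₁  = nren suc N
  R₁′ = nren suc (napp a R N)
  R₁-napp : napp (suc a) R₁ N₁ ≡ R₁′
  R₁-napp = sym (nren-napp suc a (suc-injectiveAt a) R N)
  N₁-fresh : Fresh (suc b) N₁
  N₁-fresh = Fresh-suc-nren-suc N fr
  ih : napp (suc a) (napp (suc b) M R₁) N₁ ≡ napp (suc b) (napp (suc a) M N₁) R₁′
  ih = trans (napp-napp (suc a) (suc b) (a≢b ∘ suc-injective) M R₁ N₁ N₁-fresh)
             (cong (napp (suc b) (napp (suc a) M N₁)) R₁-napp)
  proof : napp a (nappMu (suc b) γ M R₁) N ≡ napp b (nappMu (suc a) γ M N₁) (napp a R N)
  proof with γ ≟ suc b | γ ≟ suc a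
  ... | yes p | yes q = ⊥-elim (a≢b (suc-injective (trans (sym q) p)))
  ... | yes p | no q
    rewrite nappMu-≡ M R₁ p | nappMu-≢ (app (napp (suc b) M R₁) R₁) N₁ q
          | nappMu-≢ M N₁ q | nappMu-≡ (napp (suc a) M N₁) R₁′ p
    = cong₂ (λ X Y → mu γ (app X Y)) ih R₁-napp
  ... | no p | yes q
    rewrite nappMu-≢ M R₁ p | nappMu-≡ (napp (suc b) M R₁) N₁ q
          | nappMu-≡ M N₁ q | nappMu-≢ (app (napp (suc a) M N₁) N₁) R₁′ p
    = cong₂ (λ X Y → mu γ (app X Y)) ih (sym (napp-fresh (suc b) N₁ R₁′ N₁-fresh))
  ... | no p | no q
    rewrite nappMu-≢ M R₁ p | nappMu-≢ (napp (suc b) M R₁) N₁ q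
          | nappMu-≢ M N₁ q | nappMu-≢ (napp (suc a) M N₁) R₁′ p
    = cong (mu γ) ih

record Identifies (f : ℕ → ℕ) (b c d : ℕ) : Set where
  field
    fb≡d     : f b ≡ d
    fc≡d     : f c ≡ d
    preimage : ∀ x → f x ≡ d → x ≡ b ⊎ x ≡ c
    b≢c      : b ≢ c

Identifies-lift : ∀ {f b c d} → Identifies f b c d → Identifies (lift f) (suc b) (suc c) (suc d)
Identifies-lift {f} ident = record
  { fb≡d = cong suc fb≡d
  ; fc≡d = cong suc fc≡d
  ; preimage = preimage′
  ; b≢c = b≢c ∘ suc-injective
  }
  where
  open Identifies ident
  preimage′ : ∀ x → lift f x ≡ suc _ → x ≡ suc _ ⊎ x ≡ suc _
  preimage′ zero    ()
  preimage′ (suc x) q with preimage x (suc-injective q)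
  ... | inj₁ e = inj₁ (cong suc e)
  ... | inj₂ e = inj₂ (cong suc e)

nren-napp-napp : ∀ f b c d → Identifies f b c d → ∀ M N → Fresh b N →
  nren f (napp b (napp c M N) N) ≡ napp d (nren f M) (nren f N)
nren-napp-napp f b c d ident (var x)   N fr = refl
nren-napp-napp f b c d ident (lam M)   N fr =
  cong lam (trans (nren-napp-napp f b c d ident M (vren suc N) (Fresh-vren suc b N fr))
                  (cong (napp d (nren f M)) (sym (vren-nren-comm suc f N))))
nren-napp-napp f b c d ident (app M P) N fr =
  cong₂ app (nren-napp-napp f b c d ident M N fr) (nren-napp-napp f b c d ident P N fr)
nren-napp-napp f b c d ident (mu γ M)  N fr = proof
  where
  open Identifies ident
  N₁  = nren suc N
  N₁′ = nren suc (nren f N)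
  M′  = nren (lift f) M
  N₁-fresh : Fresh (suc b) N₁
  N₁-fresh = Fresh-suc-nren-suc N fr
  ih : nren (lift f) (napp (suc b) (napp (suc c) M N₁) N₁) ≡ napp (suc d) M′ N₁′
  ih = trans (nren-napp-napp (lift f) (suc b) (suc c) (suc d) (Identifies-lift ident) M N₁ N₁-fresh)
             (cong (napp (suc d) M′) (nren-suc-comm f N))
  fγ≢ : γ ≢ suc c → γ ≢ suc b → lift f γ ≢ suc d
  fγ≢ p q e with Identifies.preimage (Identifies-lift ident) γ e
  ... | inj₁ e′ = q e′
  ... | inj₂ e′ = p e′
  proof : nren f (napp b (nappMu (suc c) γ M N₁) N) ≡ nappMu (suc d) (lift f γ) M′ N₁′
  proof with γ ≟ suc c | γ ≟ suc b
  ... | yes p | yes q = ⊥-elim (b≢c (suc-injective (trans (sym q) p)))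
  ... | yes p | no q
    rewrite nappMu-≡ M N₁ p | nappMu-≢ (app (napp (suc c) M N₁) N₁) N₁ q
          | nappMu-≡ M′ N₁′ (trans (cong (lift f) p) (cong suc fc≡d))
    = cong₂ (λ X Y → mu (lift f γ) (app X Y)) ih
            (trans (cong (nren (lift f)) (napp-fresh (suc b) N₁ N₁ N₁-fresh)) (nren-suc-comm f N))
  ... | no p | yes q
    rewrite nappMu-≢ M N₁ p | nappMu-≡ (napp (suc c) M N₁) N₁ q
          | nappMu-≡ M′ N₁′ (trans (cong (lift f) q) (cong suc fb≡d))
    = cong₂ (λ X Y → mu (lift f γ) (app X Y)) ih (nren-suc-comm f N)
  ... | no p | no q
    rewrite nappMu-≢ M N₁ p | nappMu-≢ (napp (suc c) M N₁) N₁ q | nappMu-≢ M′ N₁′ (fγ≢ p q)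
    = cong (mu (lift f γ)) ih

-- Reduction under renaming, substitution and named application

_⟶*_ : Term → Term → Set
_⟶*_ = Star _⟶_

⟶-≡ : ∀ {A B B′} → A ⟶ B′ → B′ ≡ B → A ⟶ B
⟶-≡ s refl = s

⟶*-≡ : ∀ {A A′ B B′} → A ≡ A′ → A′ ⟶* B′ → B′ ≡ B → A ⟶* B
⟶*-≡ refl r refl = r

lam-⟶* : ∀ {A B} → A ⟶* B → lam A ⟶* lam B
lam-⟶* = Star.gmap lam ξlam

mu-⟶* : ∀ {β A B} → A ⟶* B → mu β A ⟶* mu β B
mu-⟶* {β} = Star.gmap (mu β) ξmu

appˡ-⟶* : ∀ {A B N} → A ⟶* B → app A N ⟶* app B N
appˡ-⟶* {N = N} = Star.gmap (λ X → app X N) ξappL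

appʳ-⟶* : ∀ {M A B} → A ⟶* B → app M A ⟶* app M B
appʳ-⟶* {M = M} = Star.gmap (app M) ξappR

rho-lift : ∀ f α η → rho (lift f α) (lift (lift f) η) ≡ lift f (rho α η)
rho-lift f α zero    = refl
rho-lift f α (suc η) = refl

vren-⟶ : ∀ f {M M′} → M ⟶ M′ → vren f M ⟶ vren f M′
vren-⟶ f (βred {M} {N}) = ⟶-≡ βred (begin
  vsub (single (vren f N)) (vren (lift f) M)  ≡⟨ vsub-vren _ (lift f) M ⟩
  vsub (λ i → single (vren f N) (lift f i)) M ≡⟨ vsub-cong (λ { zero → refl ; (suc i) → refl }) M ⟩
  vsub (λ i → vren f (single N i)) M          ≡⟨ vren-vsub f (single N) M ⟨
  vren f (vsub (single N) M)                  ∎)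
vren-⟶ f (μred {β} {M} {N}) = ⟶-≡ μred (sym (trans (vren-nappMu f zero β M (nren suc N))
  (cong (nappMu zero β (vren f M)) (vren-nren-comm f suc N))))
vren-⟶ f (ρred {α} {η} {M}) = ⟶-≡ ρred (cong (mu _) (sym (vren-nren-comm f (rho α) M)))
vren-⟶ f (ξlam s)  = ξlam (vren-⟶ (lift f) s)
vren-⟶ f (ξappL s) = ξappL (vren-⟶ f s)
vren-⟶ f (ξappR s) = ξappR (vren-⟶ f s)
vren-⟶ f (ξmu s)   = ξmu (vren-⟶ f s)

nren-⟶ : ∀ f {M M′} → M ⟶ M′ → nren f M ⟶ nren f M′
nren-⟶ f (βred {M} {N}) = ⟶-≡ βred
  (trans (vsub-cong (λ { zero → refl ; (suc i) → refl }) (nren f M)) (sym (nren-vsub f (single N) M)))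
nren-⟶ f (μred {β} {M} {N}) = ⟶-≡ μred (sym (trans
  (nren-nappMu f zero (lift-injectiveAt-zero f) β M (nren suc N))
  (cong (nappMu zero (lift f β) (nren (lift f) M)) (nren-suc-comm f N))))
nren-⟶ f (ρred {α} {η} {M}) = ⟶-≡ ρred (cong₂ mu (rho-lift f α η)
  (trans (nren-∘ _ _ M) (trans (nren-cong (rho-lift f α) M) (sym (nren-∘ _ _ M)))))
nren-⟶ f (ξlam s)  = ξlam (nren-⟶ f s)
nren-⟶ f (ξappL s) = ξappL (nren-⟶ f s)
nren-⟶ f (ξappR s) = ξappR (nren-⟶ f s)
nren-⟶ f (ξmu s)   = ξmu (nren-⟶ (lift f) s)

vsub-⟶ : ∀ σ {M M′} → M ⟶ M′ → vsub σ M ⟶ vsub σ M′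
vsub-⟶ σ (βred {M} {N}) = ⟶-≡ βred
  (trans (vsub-vsub _ (exts σ) M) (trans (vsub-cong single-exts M) (sym (vsub-vsub σ (single N) M))))
  where
  single-exts : ∀ i → vsub (single (vsub σ N)) (exts σ i) ≡ vsub σ (single N i)
  single-exts zero    = refl
  single-exts (suc i) = trans (vsub-vren _ suc (σ i)) (vsub-id (λ _ → refl) (σ i))
vsub-⟶ σ (μred {β} {M} {N}) = ⟶-≡ μred (sym (trans
  (vsub-nappMu σ zero (λ i → Fresh-zero-nren-suc (σ i)) β M (nren suc N))
  (cong (nappMu zero β (vsub (λ i → nren suc (σ i)) M)) (sym (nren-vsub suc σ N)))))
vsub-⟶ σ (ρred {α} {η} {M}) = ⟶-≡ ρred (cong (mu _) (trans
  (nren-vsub (rho α) (λ i → nren suc (nren suc (σ i))) M)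
  (vsub-cong (λ i → nren-rho-suc α (nren suc (σ i))) (nren (rho α) M))))
vsub-⟶ σ (ξlam s)  = ξlam (vsub-⟶ (exts σ) s)
vsub-⟶ σ (ξappL s) = ξappL (vsub-⟶ σ s)
vsub-⟶ σ (ξappR s) = ξappR (vsub-⟶ σ s)
vsub-⟶ σ (ξmu s)   = ξmu (vsub-⟶ _ s)

vren-⟶* : ∀ f {M M′} → M ⟶* M′ → vren f M ⟶* vren f M′
vren-⟶* f = Star.gmap (vren f) (vren-⟶ f)

nren-⟶* : ∀ f {M M′} → M ⟶* M′ → nren f M ⟶* nren f M′
nren-⟶* f = Star.gmap (nren f) (nren-⟶ f)

vsub-⟶* : ∀ σ {M M′} → M ⟶* M′ → vsub σ M ⟶* vsub σ M′
vsub-⟶* σ = Star.gmap (vsub σ) (vsub-⟶ σ)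

napp-single : ∀ α P Q N →
  napp α (vsub (single Q) P) N ≡ vsub (single (napp α Q N)) (napp α P (vren suc N))
napp-single α P Q N =
  trans (napp-vsub α (single Q) P N (vren suc N) (trans (vsub-vren _ suc N) (vsub-id (λ _ → refl) N)))
        (vsub-cong (λ { zero → refl ; (suc i) → refl }) (napp α P (vren suc N)))

napp-μ : ∀ α N β Q R → napp α (app (mu β Q) R) N ⟶ napp α (nappMu zero β Q (nren suc R)) N
napp-μ α N β Q R = proof
  where
  N₁  = nren suc N
  R₁  = nren suc R
  R₁′ = nren suc (napp α R N)
  Q′  = napp (suc α) Q N₁
  R₁-napp : napp (suc α) R₁ N₁ ≡ R₁′
  R₁-napp = sym (nren-napp suc α (suc-injectiveAt α) R N)
  commute : napp (suc α) (napp zero Q R₁) N₁ ≡ napp zero Q′ R₁′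
  commute = trans (napp-napp (suc α) zero (λ ()) Q R₁ N₁ (Fresh-zero-nren-suc N))
                  (cong (napp zero Q′) R₁-napp)
  proof : app (nappMu (suc α) β Q N₁) (napp α R N) ⟶ napp α (nappMu zero β Q R₁) N
  proof with β ≟ zero | β ≟ suc α
  ... | yes p₀ | yes p = ⊥-elim (0≢1+n (trans (sym p₀) p))
  ... | yes p₀ | no p
    rewrite nappMu-≢ Q N₁ p | nappMu-≡ Q R₁ p₀ | nappMu-≢ (app (napp zero Q R₁) R₁) N₁ p
    = ⟶-≡ μred (trans (nappMu-≡ Q′ R₁′ p₀) (sym (cong₂ (λ A B → mu β (app A B)) commute R₁-napp)))
  ... | no p₀ | yes p
    rewrite nappMu-≡ Q N₁ p | nappMu-≢ Q R₁ p₀ | nappMu-≡ (napp zero Q R₁) N₁ p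
    = ⟶-≡ μred (trans (nappMu-≢ (app Q′ N₁) R₁′ p₀)
        (cong₂ (λ A B → mu β (app A B)) (sym commute) (napp-fresh zero N₁ R₁′ (Fresh-zero-nren-suc N))))
  ... | no p₀ | no p
    rewrite nappMu-≢ Q N₁ p | nappMu-≢ Q R₁ p₀ | nappMu-≢ (napp zero Q R₁) N₁ p
    = ⟶-≡ μred (trans (nappMu-≢ Q′ R₁′ p₀) (sym (cong (mu β) commute)))

module _ (α : ℕ) (N : Term) (a η : ℕ) (M : Term) where
  private
    N₁ = nren suc N
    N₂ = nren suc N₁
    M′ = nren (rho a) M
    N₂-rho : nren (rho a) N₂ ≡ N₁
    N₂-rho = nren-rho-suc a N₁

  napp-ρ-other : a ≢ suc α → napp α (mu a (mu η M)) N ⟶ napp α (mu (rho a η) M′) N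
  napp-ρ-other a≢ = proof
    where
    inj : InjectiveAt (rho a) (suc (suc α))
    inj zero    q = ⊥-elim (a≢ q)
    inj (suc b) q = cong suc q
    rename : nren (rho a) (napp (suc (suc α)) M N₂) ≡ napp (suc α) M′ N₁
    rename = trans (nren-napp (rho a) (suc (suc α)) inj M N₂) (cong (napp (suc α) M′) N₂-rho)
    proof : nappMu (suc α) a (mu η M) N₁ ⟶ nappMu (suc α) (rho a η) M′ N₁
    proof rewrite nappMu-≢ (mu η M) N₁ a≢ with η ≟ suc (suc α)
    ... | yes q rewrite nappMu-≡ M N₂ q = ⟶-≡ ρred
      (trans (cong₂ (λ A B → mu (rho a η) (app A B)) rename N₂-rho)
             (sym (nappMu-≡ M′ N₁ (cong (rho a) q))))
    ... | no q rewrite nappMu-≢ M N₂ q = ⟶-≡ ρred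
      (trans (cong (mu (rho a η)) rename) (sym (nappMu-≢ M′ N₁ (q ∘ inj η))))

  -- When the outer name is α, named application creates a μ-redex under the
  -- outer μ; contracting it first lets the ρ-step merge the two named
  -- applications into one.
  napp-ρ-self : a ≡ suc α → napp α (mu a (mu η M)) N ⟶* napp α (mu (rho a η) M′) N
  napp-ρ-self a≡ = proof
    where
    identifies : Identifies (rho a) zero (suc (suc α)) (suc α)
    identifies = record { fb≡d = a≡ ; fc≡d = refl ; preimage = preimage ; b≢c = λ () }
      where
      preimage : ∀ x → rho a x ≡ suc α → x ≡ zero ⊎ x ≡ suc (suc α)
      preimage zero    _ = inj₁ refl
      preimage (suc x) e = inj₂ (cong suc e)
    Z = napp (suc (suc α)) M N₂
    N₂-fresh : Fresh zero N₂
    N₂-fresh = Fresh-zero-nren-suc N₁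
    merged : nren (rho a) (napp zero Z N₂) ≡ napp (suc α) M′ N₁
    merged = trans (nren-napp-napp (rho a) zero (suc (suc α)) (suc α) identifies M N₂ N₂-fresh)
                   (cong (napp (suc α) M′) N₂-rho)
    proof : nappMu (suc α) a (mu η M) N₁ ⟶* nappMu (suc α) (rho a η) M′ N₁
    proof rewrite nappMu-≡ (mu η M) N₁ a≡ with η ≟ zero | η ≟ suc (suc α)
    ... | yes q₀ | yes q = ⊥-elim (0≢1+n (trans (sym q₀) q))
    ... | yes q₀ | no q rewrite nappMu-≢ M N₂ q =
      ξmu (⟶-≡ μred (nappMu-≡ Z N₂ q₀)) ◅
      ⟶-≡ ρred (trans (cong₂ (λ A B → mu (rho a η) (app A B)) merged N₂-rho)
                      (sym (nappMu-≡ M′ N₁ (trans (cong (rho a) q₀) a≡)))) ◅ ε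
    ... | no q₀ | yes q rewrite nappMu-≡ M N₂ q =
      ξmu (⟶-≡ μred (nappMu-≢ (app Z N₂) N₂ q₀)) ◅
      ⟶-≡ ρred (trans (cong₂ (λ A B → mu (rho a η) (app A B)) merged
                             (trans (cong (nren (rho a)) (napp-fresh zero N₂ N₂ N₂-fresh)) N₂-rho))
                      (sym (nappMu-≡ M′ N₁ (cong (rho a) q)))) ◅ ε
    ... | no q₀ | no q rewrite nappMu-≢ M N₂ q =
      ξmu (⟶-≡ μred (nappMu-≢ Z N₂ q₀)) ◅
      ⟶-≡ ρred (trans (cong (mu (rho a η)) merged) (sym (nappMu-≢ M′ N₁ ρη≢))) ◅ ε
      where
      ρη≢ : rho a η ≢ suc α
      ρη≢ e with Identifies.preimage identifies η e
      ... | inj₁ e′ = q₀ e′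
      ... | inj₂ e′ = q e′

napp-⟶ : ∀ α N {M M′} → M ⟶ M′ → napp α M N ⟶* napp α M′ N
napp-⟶ α N (βred {P} {Q})     = Star.return (⟶-≡ βred (sym (napp-single α P Q N)))
napp-⟶ α N (μred {β} {Q} {R}) = Star.return (napp-μ α N β Q R)
napp-⟶ α N (ρred {a} {η} {M}) with a ≟ suc α
... | yes a≡ = napp-ρ-self α N a η M a≡
... | no a≢  = Star.return (napp-ρ-other α N a η M a≢)
napp-⟶ α N (ξlam s)  = lam-⟶* (napp-⟶ α (vren suc N) s)
napp-⟶ α N (ξappL s) = appˡ-⟶* (napp-⟶ α N s)
napp-⟶ α N (ξappR s) = appʳ-⟶* (napp-⟶ α N s)
napp-⟶ α N (ξmu {β} {M} {M′} s) with β ≟ suc α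
... | yes p = ⟶*-≡ (nappMu-≡ M (nren suc N) p) (mu-⟶* (appˡ-⟶* (napp-⟶ (suc α) (nren suc N) s)))
                    (sym (nappMu-≡ M′ (nren suc N) p))
... | no p  = ⟶*-≡ (nappMu-≢ M (nren suc N) p) (mu-⟶* (napp-⟶ (suc α) (nren suc N) s))
                    (sym (nappMu-≢ M′ (nren suc N) p))

napp-⟶* : ∀ α N {M M′} → M ⟶* M′ → napp α M N ⟶* napp α M′ N
napp-⟶* α N = Star.kleisliStar (λ X → napp α X N) (napp-⟶ α N)

-- Approximants of reducts

-- t ◁ M: t is a Taylor approximant of M after reducing M independently
-- below each node of t.
data _◁_ : RTerm → Term → Set where
  ◁var : ∀ {x M} → M ⟶* var x → rvar x ◁ M
  ◁lam : ∀ {t M P} → M ⟶* lam P → t ◁ P → rlam t ◁ M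
  ◁mu  : ∀ {β t M P} → M ⟶* mu β P → t ◁ P → rmu β t ◁ M
  ◁app : ∀ {t B M P Q} → M ⟶* app P Q → t ◁ P → All (_◁ Q) B → rapp t B ◁ M

∈T⇒◁ : ∀ {t M} → t ∈T M → t ◁ M
∈T⇒◁ Tvar          = ◁var ε
∈T⇒◁ (Tlam t∈)     = ◁lam ε (∈T⇒◁ t∈)
∈T⇒◁ (Tmu t∈)      = ◁mu ε (∈T⇒◁ t∈)
∈T⇒◁ (Tapp t∈ B∈)  = ◁app ε (∈T⇒◁ t∈) (All.map ∈T⇒◁ B∈)

◁-⟵* : ∀ {t M M′} → M ⟶* M′ → t ◁ M′ → t ◁ M
◁-⟵* r (◁var r′)       = ◁var (r ◅◅ r′)
◁-⟵* r (◁lam r′ h)     = ◁lam (r ◅◅ r′) h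
◁-⟵* r (◁mu r′ h)      = ◁mu (r ◅◅ r′) h
◁-⟵* r (◁app r′ h hB)  = ◁app (r ◅◅ r′) h hB

◁-vren : ∀ f {t M} → t ◁ M → rvren f t ◁ vren f M
◁-vrenB : ∀ f {B N} → All (_◁ N) B → All (_◁ vren f N) (rvrenB f B)
◁-vren f (◁var r)      = ◁var (vren-⟶* f r)
◁-vren f (◁lam r h)    = ◁lam (vren-⟶* f r) (◁-vren (lift f) h)
◁-vren f (◁mu r h)     = ◁mu (vren-⟶* f r) (◁-vren f h)
◁-vren f (◁app r h hB) = ◁app (vren-⟶* f r) (◁-vren f h) (◁-vrenB f hB)
◁-vrenB f []       = []
◁-vrenB f (h ∷ hB) = ◁-vren f h ∷ ◁-vrenB f hB

◁-nren : ∀ f {t M} → t ◁ M → rnren f t ◁ nren f M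
◁-nrenB : ∀ f {B N} → All (_◁ N) B → All (_◁ nren f N) (rnrenB f B)
◁-nren f (◁var r)      = ◁var (nren-⟶* f r)
◁-nren f (◁lam r h)    = ◁lam (nren-⟶* f r) (◁-nren f h)
◁-nren f (◁mu r h)     = ◁mu (nren-⟶* f r) (◁-nren (lift f) h)
◁-nren f (◁app r h hB) = ◁app (nren-⟶* f r) (◁-nren f h) (◁-nrenB f hB)
◁-nrenB f []       = []
◁-nrenB f (h ∷ hB) = ◁-nren f h ∷ ◁-nrenB f hB

concatMap⁺ : ∀ {A C : Set} {P : C → Set} {f : A → List C} {xs} →
  All (λ x → All P (f x)) xs → All P (concatMap f xs)
concatMap⁺ = concat⁺ ∘ map⁺

splits⁺ : ∀ {A : Set} {Q : A → Set} {B} → All Q B →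
  All (λ p → All Q (proj₁ p) × All Q (proj₂ p)) (splits B)
splits⁺ []       = ([] , []) ∷ []
splits⁺ (q ∷ qs) =
  concatMap⁺ (All.map (λ { (q₁ , q₂) → ((q ∷ q₁) , q₂) ∷ (q₁ , (q ∷ q₂)) ∷ [] }) (splits⁺ qs))

concatMap-splits⁺ : ∀ {A C : Set} {Q : A → Set} {P : C → Set} {f : List A × List A → List C} {B} →
  All Q B → (∀ {B₁ B₂} → All Q B₁ → All Q B₂ → All P (f (B₁ , B₂))) → All P (concatMap f (splits B))
concatMap-splits⁺ qB h = concatMap⁺ (All.map (λ { (q₁ , q₂) → h q₁ q₂ }) (splits⁺ qB))

concatMap-map⁺ : ∀ {A C D : Set} {P₁ : A → Set} {P₂ : C → Set} {P : D → Set} {g : A → C → D} {xs ys} →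
  All P₁ xs → All P₂ ys → (∀ {x y} → P₁ x → P₂ y → P (g x y)) →
  All P (concatMap (λ x → map (g x) ys) xs)
concatMap-map⁺ p₁ p₂ h = concatMap⁺ (All.map (λ q₁ → map⁺ (All.map (h q₁) p₂)) p₁)

lower : ℕ → ℕ → ℕ
lower x y = if y <ᵇ x then y else pred y

lower-suc : ∀ y x → (y ≡ᵇ x) ≡ false → suc (lower x y) ≡ lower (suc x) (suc y)
lower-suc zero    zero    ()
lower-suc zero    (suc x) _ = refl
lower-suc (suc y) zero    _ = refl
lower-suc (suc y) (suc x) _ with y <ᵇ x
... | true  = refl
... | false = refl

-- σ is the ordinary substitution that lsub x B imitates: it replaces the
-- variable x by N and closes the gap left by x.
Instantiates : (ℕ → Term) → ℕ → Term → Set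
Instantiates σ x N = σ x ≡ N × (∀ y → (y ≡ᵇ x) ≡ false → σ y ≡ var (lower x y))

Instantiates-single : ∀ N → Instantiates (single N) zero N
Instantiates-single N = refl , λ { zero () ; (suc y) _ → refl }

Instantiates-exts : ∀ {σ x N} → Instantiates σ x N → Instantiates (exts σ) (suc x) (vren suc N)
Instantiates-exts {σ} {x} (σx , σ-other) = cong (vren suc) σx , exts-other
  where
  exts-other : ∀ y → (y ≡ᵇ suc x) ≡ false → exts σ y ≡ var (lower (suc x) y)
  exts-other zero    _ = refl
  exts-other (suc y) e = trans (cong (vren suc) (σ-other y e)) (cong var (lower-suc y x e))

Instantiates-nren-suc : ∀ {σ x N} → Instantiates σ x N →
  Instantiates (λ i → nren suc (σ i)) x (nren suc N)
Instantiates-nren-suc (σx , σ-other) = cong (nren suc) σx , λ y e → cong (nren suc) (σ-other y e)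

lsubVar-◁ : ∀ {P y} → P ⟶* var y → ∀ x B N σ → All (_◁ N) B → Instantiates σ x N →
  All (_◁ vsub σ P) (lsubVar x B y)
lsubVar-◁ {y = y} r x [] N σ [] (_ , σ-other) with y ≡ᵇ x in eq
... | true  = []
... | false = ◁var (⟶*-≡ refl (vsub-⟶* σ r) (σ-other y eq)) ∷ []
lsubVar-◁ {y = y} r x (_ ∷ []) N σ (hv ∷ []) (σx , _) with y ≡ᵇ x in eq
... | true  = ◁-⟵* (⟶*-≡ refl (vsub-⟶* σ r) (trans (cong σ y≡x) σx)) hv ∷ []
  where y≡x = ≡ᵇ⇒≡ y x (subst T (sym eq) tt)
... | false = []
lsubVar-◁ r x (_ ∷ _ ∷ _) N σ _ _ = []

lsub-◁ : ∀ {t P} → t ◁ P → ∀ x B N σ → All (_◁ N) B → Instantiates σ x N →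
  All (_◁ vsub σ P) (lsub x B t)
lsubB-◁ : ∀ {vs Q} → All (_◁ Q) vs → ∀ x B N σ → All (_◁ N) B → Instantiates σ x N →
  All (All (_◁ vsub σ Q)) (lsubB x B vs)
lsub-◁ (◁var r) x B N σ hB inst = lsubVar-◁ r x B N σ hB inst
lsub-◁ (◁lam r h) x B N σ hB inst = map⁺ (All.map (◁lam (vsub-⟶* σ r))
  (lsub-◁ h (suc x) (rvrenB suc B) (vren suc N) (exts σ) (◁-vrenB suc hB) (Instantiates-exts inst)))
lsub-◁ (◁mu r h) x B N σ hB inst = map⁺ (All.map (◁mu (vsub-⟶* σ r))
  (lsub-◁ h x (rnrenB suc B) (nren suc N) _ (◁-nrenB suc hB) (Instantiates-nren-suc inst)))
lsub-◁ (◁app r h hvs) x B N σ hB inst = concatMap-splits⁺ hB λ h₁ h₂ →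
  concatMap-map⁺ (lsub-◁ h x _ N σ h₁ inst) (lsubB-◁ hvs x _ N σ h₂ inst) (◁app (vsub-⟶* σ r))
lsubB-◁ [] x []      N σ hB inst = [] ∷ []
lsubB-◁ [] x (_ ∷ _) N σ hB inst = []
lsubB-◁ (hv ∷ hvs) x [] N σ hB inst = concatMap-splits⁺ hB λ h₁ h₂ →
  concatMap-map⁺ (lsub-◁ hv x _ N σ h₁ inst) (lsubB-◁ hvs x _ N σ h₂ inst) _∷_
lsubB-◁ (hv ∷ hvs) x (_ ∷ _) N σ hB inst = concatMap-splits⁺ hB λ h₁ h₂ →
  concatMap-map⁺ (lsub-◁ hv x _ N σ h₁ inst) (lsubB-◁ hvs x _ N σ h₂ inst) _∷_

lnapp-◁ : ∀ {t P} → t ◁ P → ∀ α B N → All (_◁ N) B → All (_◁ napp α P N) (lnapp α B t)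
lnappB-◁ : ∀ {vs Q} → All (_◁ Q) vs → ∀ α B N → All (_◁ N) B →
  All (All (_◁ napp α Q N)) (lnappB α B vs)
lnappMu-◁ : ∀ {t P} → t ◁ P → ∀ a β B N → All (_◁ N) B →
  All (_◁ nappMu a β P N) (lnappMu a β B t)
lnapp-◁ (◁var r) α [] N hB = ◁var (napp-⟶* α N r) ∷ []
lnapp-◁ (◁var r) α (_ ∷ _) N hB = []
lnapp-◁ (◁lam r h) α [] N hB =
  map⁺ (All.map (◁lam (napp-⟶* α N r)) (lnapp-◁ h α [] (vren suc N) []))
lnapp-◁ (◁lam r h) α B@(_ ∷ _) N hB =
  map⁺ (All.map (◁lam (napp-⟶* α N r)) (lnapp-◁ h α (rvrenB suc B) (vren suc N) (◁-vrenB suc hB)))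
lnapp-◁ (◁mu {β} r h) α [] N hB =
  All.map (◁-⟵* (napp-⟶* α N r)) (lnappMu-◁ h (suc α) β [] (nren suc N) [])
lnapp-◁ (◁mu {β} r h) α B@(_ ∷ _) N hB =
  All.map (◁-⟵* (napp-⟶* α N r))
          (lnappMu-◁ h (suc α) β (rnrenB suc B) (nren suc N) (◁-nrenB suc hB))
lnapp-◁ (◁app r h hvs) α [] N hB = concatMap-splits⁺ hB λ h₁ h₂ →
  concatMap-map⁺ (lnapp-◁ h α _ N h₁) (lnappB-◁ hvs α _ N h₂) (◁app (napp-⟶* α N r))
lnapp-◁ (◁app r h hvs) α (_ ∷ _) N hB = concatMap-splits⁺ hB λ h₁ h₂ →
  concatMap-map⁺ (lnapp-◁ h α _ N h₁) (lnappB-◁ hvs α _ N h₂) (◁app (napp-⟶* α N r))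
lnappB-◁ [] α []      N hB = [] ∷ []
lnappB-◁ [] α (_ ∷ _) N hB = []
lnappB-◁ (hv ∷ hvs) α [] N hB = concatMap-splits⁺ hB λ h₁ h₂ →
  concatMap-map⁺ (lnapp-◁ hv α _ N h₁) (lnappB-◁ hvs α _ N h₂) _∷_
lnappB-◁ (hv ∷ hvs) α (_ ∷ _) N hB = concatMap-splits⁺ hB λ h₁ h₂ →
  concatMap-map⁺ (lnapp-◁ hv α _ N h₁) (lnappB-◁ hvs α _ N h₂) _∷_
lnappMu-◁ h a β B N hB with β ≡ᵇ a
... | true  = concatMap-splits⁺ hB λ h₁ h₂ →
  map⁺ (All.map (λ ht → ◁mu ε (◁app ε ht h₂)) (lnapp-◁ h a _ N h₁))
... | false = map⁺ (All.map (◁mu ε) (lnapp-◁ h a B N hB))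

⟶r-◁ : ∀ {t S M} → t ⟶r S → t ◁ M → All (_◁ M) S
⟶r-◁ (rβ {t} {B}) (◁app {Q = Q} r (◁lam r′ h) hB) =
  All.map (◁-⟵* (r ◅◅ appˡ-⟶* r′ ◅◅ Star.return βred))
          (lsub-◁ h zero B Q (single Q) hB (Instantiates-single Q))
⟶r-◁ (rμ {β} {t} {B}) (◁app {Q = Q} r (◁mu r′ h) hB) =
  All.map (◁-⟵* (r ◅◅ appˡ-⟶* r′ ◅◅ Star.return μred))
          (lnappMu-◁ h zero β (rnrenB suc B) (nren suc Q) (◁-nrenB suc hB))
⟶r-◁ (rρ {α}) (◁mu r (◁mu r′ h)) =
  ◁mu (r ◅◅ mu-⟶* r′ ◅◅ Star.return ρred) (◁-nren (rho α) h) ∷ []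
⟶r-◁ (rξlam s)  (◁lam r h)    = map⁺ (All.map (◁lam r) (⟶r-◁ s h))
⟶r-◁ (rξmu s)   (◁mu r h)     = map⁺ (All.map (◁mu r) (⟶r-◁ s h))
⟶r-◁ (rξappL s) (◁app r h hB) = map⁺ (All.map (λ h′ → ◁app r h′ hB) (⟶r-◁ s h))
⟶r-◁ (rξappB {B₁ = B₁} s) (◁app r hu hB) with ++⁻ B₁ hB
... | hB₁ , (h ∷ hB₂) = map⁺ (All.map (λ h′ → ◁app r hu (++⁺ hB₁ (h′ ∷ hB₂))) (⟶r-◁ s h))

⟹-◁ : ∀ {S S′ M} → S ⟹ S′ → All (_◁ M) S → All (_◁ M) S′
⟹-◁ (step {S₁} s) hS with ++⁻ S₁ hS
... | hS₁ , (h ∷ hS₂) = ++⁺ hS₁ (++⁺ (⟶r-◁ s h) hS₂)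

⟹*-◁ : ∀ {S S′ M} → Star _⟹_ S S′ → All (_◁ M) S → All (_◁ M) S′
⟹*-◁ ε        hS = hS
⟹*-◁ (s ◅ ss) hS = ⟹*-◁ ss (⟹-◁ s hS)

IsVarApp-¬IsMu : ∀ {H} → IsVarApp H → ¬ IsMu H
IsVarApp-¬IsMu ivar     ()
IsVarApp-¬IsMu (iapp _) ()

normal-app-◁⇒IsVarApp : ∀ {t B M} → RNormal (rapp t B) → rapp t B ◁ M →
  ∃[ H ] (IsVarApp H × M ⟶* H)
normal-app-◁⇒IsVarApp nf (◁app {Q = Q} r (◁var r′) _) =
  app (var _) Q , iapp ivar , (r ◅◅ appˡ-⟶* r′)
normal-app-◁⇒IsVarApp nf (◁app {Q = Q} r h@(◁app _ _ _) _)
  with normal-app-◁⇒IsVarApp (nf ∘ rξappL) h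
... | H , isVarApp , r′ = app H Q , iapp isVarApp , (r ◅◅ appˡ-⟶* r′)
normal-app-◁⇒IsVarApp nf (◁app _ (◁lam _ _) _) = ⊥-elim (nf rβ)
normal-app-◁⇒IsVarApp nf (◁app _ (◁mu _ _) _)  = ⊥-elim (nf rμ)

-- The extra component records that the head normal form starts with μ only
-- if the approximant does, which rules out a ρ-redex in the head.
normal-◁⇒HNF : ∀ {t M} → RNormal t → t ◁ M →
  ∃[ H ] (HNF H × M ⟶* H × (IsMu H → ∃[ β ] ∃[ u ] t ≡ rmu β u))
normal-◁⇒HNF nf (◁var {x} r) = var x , hvar ivar , r , λ ()
normal-◁⇒HNF nf (◁lam r h) with normal-◁⇒HNF (nf ∘ rξlam) h
... | H , hnf , r′ , _ = lam H , hlam hnf , (r ◅◅ lam-⟶* r′) , λ ()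
normal-◁⇒HNF nf (◁mu {β} {t} r h) with normal-◁⇒HNF (nf ∘ rξmu) h
... | H , hnf , r′ , headMu = mu β H , hmu noρ hnf , (r ◅◅ mu-⟶* r′) , λ _ → β , t , refl
  where
  noρ : ¬ IsMu H
  noρ isMu with headMu isMu
  ... | _ , _ , refl = nf rρ
normal-◁⇒HNF nf h@(◁app _ _ _) with normal-app-◁⇒IsVarApp nf h
... | H , isVarApp , r = H , hvar isVarApp , r , λ isMu → ⊥-elim (IsVarApp-¬IsMu isVarApp isMu)

∈NF⇒Solvable : ∀ {u M} → u ∈NF M → Solvable M
∈NF⇒Solvable {u} {M} (t , t∈ , S , t⟹*S , normal , u∈S) =
  witness (⟹*-◁ t⟹*S (∈T⇒◁ t∈ ∷ [])) normal u∈S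
  where
  witness : ∀ {S} → All (_◁ M) S → All RNormal S → Any (_~ u) S → Solvable M
  witness (h ∷ _)  (nf ∷ _)  (here _) with normal-◁⇒HNF nf h
  ... | H , hnf , r , _ = H , hnf , Star.map fwd r
  witness (_ ∷ hs) (_ ∷ nfs) (there u∈) = witness hs nfs u∈

corollary3p15 : ∀ M N → Unsolvable M → Unsolvable N → M ≡T N
corollary3p15 M N unsolvM unsolvN u =
  ⊥-elim ∘ unsolvM ∘ ∈NF⇒Solvable , ⊥-elim ∘ unsolvN ∘ ∈NF⇒Solvable
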